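{- Let $H=(V,E)$ be a hypergraph with at least one edge, without empty edges, such that $|e|$ is even for all $e\in E$, and let $H^T=(E,V^T)$ be its dual. Let $E'\subseteq E$. Then $(V,E')$ is a 2-factor of $H$ if and only if $H^T$ has an Euler family with anchor set $E'$ that traverses every vertex $e\in E'$ exactly $|e|/2$ times; and $(V,E')$ is a connected 2-factor of $H$ if and only if $H^T$ has an Euler tour with anchor set $E'$ that traverses every vertex $e\in E'$ exactly $|e|/2$ times.
   Context: A hypergraph $H=(V,E)$ has a nonempty finite vertex set $V$ and a finite set $E$ of edges, each associated with a subset of $V$ (parallel edges allowed). The dual of $H$ (with $E\ne\emptyset$) is the hypergraph $H^T=(E,V^T)$ whose vertex set is $E$ and whose edges are $v^T=\{e\in E: v\in e\}$ for $v\in V$. A 2-factor of $H$ is a spanning hypersubgraph $(V,E')$, $E'\subseteq E$, in which every vertex of $V$ lies in exactly two edges of $E'$. A walk is $v_0e_1v_1\dots e_kv_k$ with $v_{i-1}\ne v_i$, $v_{i-1},v_i\in e_i$; its anchors are $v_0,\dots,v_k$; it is closed if $k\ge2$ and $v_0=v_k$; a strict trail if $e_1,\dots,e_k$ are pairwise distinct; a hypergraph is connected if any two distinct vertices are joined by a walk. The number of times a closed walk traverses a vertex is the number of indices $i\in\{1,\dots,k\}$ with $v_i$ equal to it (the two endpoints counting as one traversal). An Euler tour is a closed strict trail traversing every edge; an Euler family is a family of pairwise anchor-disjoint closed strict trails such that each edge lies in exactly one of them; its anchor set is the set of all anchors of its trails. -}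

module Defs where

open import Data.Nat using (ℕ; zero; suc; _+_; _≤_; _/_)
open import Data.Nat.Divisibility using (_∣_)
open import Data.Bool using (Bool; true; false; if_then_else_)
open import Data.Fin using (Fin) renaming (_≟_ to _≟F_)
import Data.Fin as F
open import Data.List using (List; []; _∷_; map; length; filter)
open import Data.Nat.ListAction using (sum)
open import Data.List.Membership.Propositional using (_∈_)
open import Data.List.Relation.Unary.All using (All)
open import Data.List.Relation.Unary.Unique.Propositional using (Unique)
open import Data.List.Relation.Unary.AllPairs using (AllPairs)
import Data.List.Membership.DecPropositional as DecMem
open import Data.Product using (Σ; _×_; _,_; proj₁; proj₂)
open import Data.Unit using (⊤)
open import Data.Empty using (⊥)
open import Relation.Nullary using (¬_; does)
open import Relation.Binary.PropositionalEquality using (_≡_; _≢_)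

-- A finite hypergraph: vertex set Fin nV, edges indexed by Fin nE (parallel
-- edges allowed), incidence inc e v = true iff vertex v lies in edge e.
record Hypergraph : Set where
  field
    nV  : ℕ
    nE  : ℕ
    inc : Fin nE → Fin nV → Bool
open Hypergraph public

countF : {k : ℕ} → (Fin k → Bool) → ℕ
countF {zero}  p = 0
countF {suc k} p = (if p F.zero then 1 else 0) + countF (λ i → p (F.suc i))

edgeSize : (H : Hypergraph) → Fin (nE H) → ℕ
edgeSize H e = countF (inc H e)

dual : Hypergraph → Hypergraph
dual H = record { nV = nE H ; nE = nV H ; inc = λ v e → inc H e v }

-- A walk v0 e1 v1 ... ek vk : start vertex and list of steps (e_i , v_i)
record Walk (H : Hypergraph) : Set where
  constructor mkWalk
  field
    start : Fin (nV H)
    steps : List (Fin (nE H) × Fin (nV H))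
open Walk public

ValidFrom : (H : Hypergraph) → Fin (nV H) → List (Fin (nE H) × Fin (nV H)) → Set
ValidFrom H v [] = ⊤
ValidFrom H v ((e , w) ∷ rest) =
  (v ≢ w) × (inc H e v ≡ true) × (inc H e w ≡ true) × ValidFrom H w rest

IsWalk : (H : Hypergraph) → Walk H → Set
IsWalk H W = ValidFrom H (start W) (steps W)

edgesOf : {H : Hypergraph} → Walk H → List (Fin (nE H))
edgesOf W = map proj₁ (steps W)

anchors : {H : Hypergraph} → Walk H → List (Fin (nV H))
anchors W = start W ∷ map proj₂ (steps W)

lastOr : {A : Set} → A → List A → A
lastOr d [] = d
lastOr d (x ∷ xs) = lastOr x xs

endV : {H : Hypergraph} → Walk H → Fin (nV H)
endV W = lastOr (start W) (map proj₂ (steps W))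

IsClosed : {H : Hypergraph} → Walk H → Set
IsClosed W = (2 ≤ length (steps W)) × (endV W ≡ start W)

IsStrict : {H : Hypergraph} → Walk H → Set
IsStrict W = Unique (edgesOf W)

IsClosedStrictTrail : (H : Hypergraph) → Walk H → Set
IsClosedStrictTrail H W = IsWalk H W × IsClosed W × IsStrict W

-- number of indices i ∈ {1..k} with v_i = x
traversals : {H : Hypergraph} → Walk H → Fin (nV H) → ℕ
traversals W x = length (filter (λ y → y ≟F x) (map proj₂ (steps W)))

Disjoint : {k : ℕ} → List (Fin k) → List (Fin k) → Set
Disjoint xs ys = ∀ x → x ∈ xs → x ∈ ys → ⊥

IsEulerFamily : (H : Hypergraph) → List (Walk H) → Set
IsEulerFamily H Ws =
  All (IsClosedStrictTrail H) Ws ×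
  AllPairs (λ W₁ W₂ → Disjoint (anchors W₁) (anchors W₂)) Ws ×
  (∀ (e : Fin (nE H)) → length (filter (λ W → DecMem._∈?_ (_≟F_ {nE H}) e (edgesOf W)) Ws) ≡ 1)

familyAnchorSetIs : (H : Hypergraph) → List (Walk H) → (Fin (nV H) → Bool) → Set
familyAnchorSetIs H Ws A =
  ∀ (x : Fin (nV H)) → ((Σ (Walk H) (λ W → (W ∈ Ws) × (x ∈ anchors W))) → A x ≡ true)
  × (A x ≡ true → Σ (Walk H) (λ W → (W ∈ Ws) × (x ∈ anchors W)))

familyTraversals : {H : Hypergraph} → List (Walk H) → Fin (nV H) → ℕ
familyTraversals Ws x = sum (map (λ W → traversals W x) Ws)

IsEulerTour : (H : Hypergraph) → Walk H → Set
IsEulerTour H W = IsClosedStrictTrail H W × (∀ (e : Fin (nE H)) → e ∈ edgesOf W)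

tourAnchorSetIs : (H : Hypergraph) → Walk H → (Fin (nV H) → Bool) → Set
tourAnchorSetIs H W A =
  ∀ (x : Fin (nV H)) → (x ∈ anchors W → A x ≡ true) × (A x ≡ true → x ∈ anchors W)

IsTwoFactor : (H : Hypergraph) → (Fin (nE H) → Bool) → Set
IsTwoFactor H E' =
  ∀ (v : Fin (nV H)) → countF (λ e → Data.Bool._∧_ (E' e) (inc H e v)) ≡ 2
  where import Data.Bool

IsConnectedSub : (H : Hypergraph) → (Fin (nE H) → Bool) → Set
IsConnectedSub H E' =
  ∀ (u v : Fin (nV H)) → u ≢ v →
  Σ (Walk H) (λ W → IsWalk H W × (start W ≡ u) × (endV W ≡ v) ×
                    All (λ e → E' e ≡ true) (edgesOf W))

module Submission where

-- If E′ is a 2-factor, every vertex v of H lies in exactly two edges p v ≠ q v of E′, so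
-- replacing the dual edge v by the graph edge {p v, q v} turns the dual into a loopless
-- multigraph in which e ∈ E′ has degree |e| and every other edge of H degree 0. All degrees
-- are even, so the edges split into vertex-disjoint closed trails: peel off an edge, follow
-- unused edges from one of its ends until the walk is forced back to the other (the only
-- other odd vertex), and merge the new circuit with every circuit it meets. A closed trail
-- through e uses two edges at e per visit, so e is traversed |e|/2 times.
--
-- Conversely, the step of an Euler family along the dual edge v joins two distinct anchors
-- containing v, so v lies in at least two edges of E′; and counting incidences,
-- Σ_v #{e ∈ E′ : v ∈ e} = Σ_{e ∈ E′} |e| = 2 · Σ traversals = 2 |V|, forcing equality.
--
-- For tours: two edges of E′ sharing a vertex x are the two anchors of the step along x,
-- so a walk in (V, E′) never leaves the anchors of one trail, and connectedness leaves room
-- for a single trail. Conversely, the segment of a tour between the dual edges u and v,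
-- read in H, is a walk from u to v inside E′.

open import Defs

open import Data.Bool using (Bool; true; false; if_then_else_; _∧_)
open import Data.Empty using (⊥; ⊥-elim)
open import Data.Fin using (Fin; zero; suc; _≟_)
import Data.Fin.Properties as Finₚ
open import Data.List using (List; []; _∷_; _++_; map; length; filter; concatMap; tabulate; allFin)
import Data.List.Properties as Listₚ
open import Data.List.Membership.Propositional using (_∈_; find; lose)
import Data.List.Membership.DecPropositional as DecMembership
open import Data.List.Membership.Propositional.Properties
  using (∈-++⁺ˡ; ∈-++⁺ʳ; ∈-++⁻; ∈-map⁺; ∈-map⁻; ∈-∃++; ∈-tabulate⁺; ∈-concatMap⁻; ∈-filter⁻)
open import Data.List.Relation.Binary.Permutation.Propositional
  using (_↭_; ↭⇒↭ₛ; ↭-refl; ↭-sym; ↭-trans; prep)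
open import Data.List.Relation.Binary.Permutation.Propositional.Properties
  using (∈-resp-↭; All-resp-↭; ↭-length; shift; shifts; ++⁺; ++⁺ˡ; ++⁺ʳ)
  renaming (map⁺ to ↭-map⁺; ++-comm to ↭-++-comm; ++-assoc to ↭-++-assoc)
import Data.List.Relation.Binary.Permutation.Setoid.Properties as PermSetoid
open import Data.List.Relation.Unary.All using (All; []; _∷_)
import Data.List.Relation.Unary.All as All
import Data.List.Relation.Unary.All.Properties as AllP
open import Data.List.Relation.Unary.AllPairs using (AllPairs; []; _∷_)
import Data.List.Relation.Unary.AllPairs as AllPairs
open import Data.List.Relation.Unary.Any using (here; there; any?)
open import Data.List.Relation.Unary.Unique.Propositional using (Unique)
import Data.List.Relation.Unary.Unique.Propositional.Properties as Uniqueₚ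
open import Data.Nat using (ℕ; zero; suc; _+_; _*_; _≤_; _<_; _/_; z≤n; s≤s; parity)
open import Data.Nat.DivMod using (m*n/n≡m)
open import Data.Nat.Divisibility using (_∣_; divides)
open import Data.Nat.Induction using (<-wellFounded)
open import Data.Nat.ListAction using (sum)
open import Data.Nat.ListAction.Properties using (sum-++; sum-↭)
open import Data.Nat.Properties hiding (_≟_)
open import Algebra.Properties.CommutativeMonoid.Sum +-0-commutativeMonoid
  using (∑-distrib-+; ∑-comm; sum-cong-≗; sum-replicate-zero)
  renaming (sum to ∑)
open import Data.Nat.Solver using (module +-*-Solver)
open import Data.Parity.Base as ℙ using (Parity; 0ℙ; 1ℙ)
import Data.Parity.Properties as Parityₚ
open import Data.Product using (Σ; ∃; _×_; _,_; proj₁; proj₂)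
import Data.Product
open import Data.Sum using (_⊎_; inj₁; inj₂)
import Data.Sum
open import Data.Unit using (⊤; tt)
open import Function using (_∘_; case_of_)
open import Function.Bundles using (_⇔_; mk⇔)
open import Induction.WellFounded using (Acc; acc)
open import Relation.Binary.PropositionalEquality
open import Relation.Nullary using (¬_; does; yes; no)
import Relation.Unary

-- Counting and summing over Fin

iverson : Bool → ℕ
iverson b = if b then 1 else 0

δ : ∀ {n} → Fin n → Fin n → ℕ
δ x y = iverson (does (x ≟ y))

δ-≡ : ∀ {n} {x y : Fin n} → x ≡ y → δ x y ≡ 1
δ-≡ {x = x} {y} x≡y with x ≟ y
... | yes _ = refl
... | no x≢y = ⊥-elim (x≢y x≡y)

δ-≢ : ∀ {n} {x y : Fin n} → x ≢ y → δ x y ≡ 0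
δ-≢ {x = x} {y} x≢y with x ≟ y
... | yes x≡y = ⊥-elim (x≢y x≡y)
... | no _ = refl

δ-sym : ∀ {n} (x y : Fin n) → δ x y ≡ δ y x
δ-sym x y with x ≟ y | y ≟ x
... | yes _ | yes _ = refl
... | no _ | no _ = refl
... | yes x≡y | no y≢x = ⊥-elim (y≢x (sym x≡y))
... | no x≢y | yes y≡x = ⊥-elim (x≢y (sym y≡x))

true≢false : true ≢ false
true≢false ()

∧-true⁻ : ∀ {a b} → a ∧ b ≡ true → a ≡ true × b ≡ true
∧-true⁻ {true} {true} _ = refl , refl

∧-true⁺ : ∀ {a b} → a ≡ true → b ≡ true → a ∧ b ≡ true
∧-true⁺ refl refl = refl

countF≡∑ : ∀ {n} (f : Fin n → Bool) → countF f ≡ ∑ (iverson ∘ f)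
countF≡∑ {zero} f = refl
countF≡∑ {suc n} f = cong (iverson (f zero) +_) (countF≡∑ (f ∘ suc))

countF-false : ∀ {n} → countF {n} (λ _ → false) ≡ 0
countF-false {zero} = refl
countF-false {suc n} = countF-false {n}

countF≡0⇒false : ∀ {n} (f : Fin n → Bool) → countF f ≡ 0 → ∀ i → f i ≢ true
countF≡0⇒false {suc n} f c i fi with f zero in f₀
countF≡0⇒false {suc n} f () i fi | true
countF≡0⇒false {suc n} f c zero fi | false = true≢false (trans (sym fi) f₀)
countF≡0⇒false {suc n} f c (suc i) fi | false = countF≡0⇒false (f ∘ suc) c i fi

countF≡1⇒unique : ∀ {n} (f : Fin n → Bool) → countF f ≡ 1 →
                  Σ (Fin n) λ i → f i ≡ true × (∀ j → f j ≡ true → j ≡ i)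
countF≡1⇒unique {suc n} f c with f zero in f₀
... | true = zero , f₀ , only-zero
  where
  only-zero : ∀ j → f j ≡ true → j ≡ zero
  only-zero zero _ = refl
  only-zero (suc j) fj = ⊥-elim (countF≡0⇒false (f ∘ suc) (suc-injective c) j fj)
... | false with countF≡1⇒unique (f ∘ suc) c
...   | i , fi , unique = suc i , fi , only-suc
  where
  only-suc : ∀ j → f j ≡ true → j ≡ suc i
  only-suc zero fj = ⊥-elim (true≢false (trans (sym fj) f₀))
  only-suc (suc j) fj = cong suc (unique j fj)

record ExactlyTwo {n} (f : Fin n → Bool) : Set where
  field
    fst snd : Fin n
    fst≢snd : fst ≢ snd
    f-fst : f fst ≡ true
    f-snd : f snd ≡ true
    fst-or-snd : ∀ k → f k ≡ true → k ≡ fst ⊎ k ≡ snd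

  any-two : ∀ {i j} → i ≢ j → f i ≡ true → f j ≡ true → ∀ k → f k ≡ true → k ≡ i ⊎ k ≡ j
  any-two {i} {j} i≢j fi fj k fk with fst-or-snd i fi | fst-or-snd j fj | fst-or-snd k fk
  ... | inj₁ i≡a | inj₁ j≡a | _ = ⊥-elim (i≢j (trans i≡a (sym j≡a)))
  ... | inj₂ i≡b | inj₂ j≡b | _ = ⊥-elim (i≢j (trans i≡b (sym j≡b)))
  ... | inj₁ i≡a | inj₂ _ | inj₁ k≡a = inj₁ (trans k≡a (sym i≡a))
  ... | inj₁ _ | inj₂ j≡b | inj₂ k≡b = inj₂ (trans k≡b (sym j≡b))
  ... | inj₂ _ | inj₁ j≡a | inj₁ k≡a = inj₂ (trans k≡a (sym j≡a))
  ... | inj₂ i≡b | inj₁ _ | inj₂ k≡b = inj₁ (trans k≡b (sym i≡b))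

countF≡2⇒ExactlyTwo : ∀ {n} (f : Fin n → Bool) → countF f ≡ 2 → ExactlyTwo f
countF≡2⇒ExactlyTwo {suc n} f c with f zero in f₀
... | true with countF≡1⇒unique (f ∘ suc) (suc-injective c)
...   | j , fj , unique = record
  { fst = zero ; snd = suc j ; fst≢snd = λ () ; f-fst = f₀ ; f-snd = fj ; fst-or-snd = zero-or-suc }
  where
  zero-or-suc : ∀ k → f k ≡ true → k ≡ zero ⊎ k ≡ suc j
  zero-or-suc zero _ = inj₁ refl
  zero-or-suc (suc k) fk = inj₂ (cong suc (unique k fk))
countF≡2⇒ExactlyTwo {suc n} f c | false with countF≡2⇒ExactlyTwo (f ∘ suc) c
... | two = record
  { fst = suc fst ; snd = suc snd ; fst≢snd = fst≢snd ∘ Finₚ.suc-injective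
  ; f-fst = f-fst ; f-snd = f-snd ; fst-or-snd = suc-either }
  where
  open ExactlyTwo two
  suc-either : ∀ k → f k ≡ true → k ≡ suc fst ⊎ k ≡ suc snd
  suc-either zero fk = ⊥-elim (true≢false (trans (sym fk) f₀))
  suc-either (suc k) fk = Data.Sum.map (cong suc) (cong suc) (fst-or-snd k fk)

countF-witness : ∀ {n} (f : Fin n → Bool) → 1 ≤ countF f → ∃ λ i → f i ≡ true
countF-witness {suc n} f c with f zero in f₀
... | true = zero , f₀
... | false with countF-witness (f ∘ suc) c
...   | i , fi = suc i , fi

countF-≥1 : ∀ {n} (f : Fin n → Bool) i → f i ≡ true → 1 ≤ countF f
countF-≥1 f zero fi rewrite fi = s≤s z≤n
countF-≥1 f (suc i) fi with f zero
... | true = s≤s z≤n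
... | false = countF-≥1 (f ∘ suc) i fi

countF-≥2 : ∀ {n} (f : Fin n → Bool) {i j} → i ≢ j → f i ≡ true → f j ≡ true → 2 ≤ countF f
countF-≥2 f {zero} {zero} i≢j _ _ = ⊥-elim (i≢j refl)
countF-≥2 f {zero} {suc j} _ fi fj rewrite fi = s≤s (countF-≥1 (f ∘ suc) j fj)
countF-≥2 f {suc i} {zero} _ fi fj rewrite fj = s≤s (countF-≥1 (f ∘ suc) i fi)
countF-≥2 f {suc i} {suc j} i≢j fi fj with f zero
... | true = ≤-trans (countF-≥2 (f ∘ suc) (i≢j ∘ cong suc) fi fj) (n≤1+n _)
... | false = countF-≥2 (f ∘ suc) (i≢j ∘ cong suc) fi fj

∑-mono-≤ : ∀ {n} {f g : Fin n → ℕ} → (∀ i → f i ≤ g i) → ∑ f ≤ ∑ g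
∑-mono-≤ {zero} _ = z≤n
∑-mono-≤ {suc n} f≤g = +-mono-≤ (f≤g zero) (∑-mono-≤ (f≤g ∘ suc))

∑-squeeze : ∀ {n} (f g : Fin n → ℕ) → (∀ i → f i ≤ g i) → ∑ g ≤ ∑ f → ∀ i → f i ≡ g i
∑-squeeze {suc n} f g f≤g ∑g≤∑f zero = ≤-antisym (f≤g zero)
  (+-cancelʳ-≤ (∑ (g ∘ suc)) _ _ (≤-trans ∑g≤∑f (+-monoʳ-≤ (f zero) (∑-mono-≤ (f≤g ∘ suc)))))
∑-squeeze {suc n} f g f≤g ∑g≤∑f (suc i) = ∑-squeeze (f ∘ suc) (g ∘ suc) (f≤g ∘ suc)
  (+-cancelˡ-≤ (g zero) _ _ (≤-trans ∑g≤∑f (+-monoˡ-≤ _ (f≤g zero)))) i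

∑-δ : ∀ {n} (x : Fin n) → ∑ (δ x) ≡ 1
∑-δ {suc n} zero = cong suc (sum-replicate-zero n)
∑-δ {suc n} (suc x) = ∑-δ x

∑-sum-comm : ∀ {n} {A : Set} (g : A → Fin n → ℕ) (L : List A) →
             ∑ (λ i → sum (map (λ a → g a i) L)) ≡ sum (map (λ a → ∑ (g a)) L)
∑-sum-comm {n} g [] = sum-replicate-zero n
∑-sum-comm g (a ∷ L) = trans (∑-distrib-+ (g a) _) (cong (∑ (g a) +_) (∑-sum-comm g L))

length-filter≡sum : {A : Set} {P : A → Set} (P? : Relation.Unary.Decidable P) (L : List A) →
                    length (filter P? L) ≡ sum (map (iverson ∘ does ∘ P?) L)
length-filter≡sum P? [] = refl
length-filter≡sum P? (a ∷ L) with P? a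
... | yes _ = cong suc (length-filter≡sum P? L)
... | no _ = length-filter≡sum P? L

occurrences : ∀ {n} → List (Fin n) → Fin n → ℕ
occurrences L x = length (filter (_≟ x) L)

occurrences-∷ : ∀ {n} (y : Fin n) L x → occurrences (y ∷ L) x ≡ δ y x + occurrences L x
occurrences-∷ y L x with y ≟ x
... | yes _ = refl
... | no _ = refl

∑-occurrences : ∀ {n} (L : List (Fin n)) → ∑ (occurrences L) ≡ length L
∑-occurrences {n} [] = sum-replicate-zero n
∑-occurrences (y ∷ L) = begin
  ∑ (occurrences (y ∷ L))              ≡⟨ sum-cong-≗ (occurrences-∷ y L) ⟩
  ∑ (λ x → δ y x + occurrences L x)    ≡⟨ ∑-distrib-+ (δ y) (occurrences L) ⟩
  ∑ (δ y) + ∑ (occurrences L)          ≡⟨ cong₂ _+_ (∑-δ y) (∑-occurrences L) ⟩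
  suc (length L)                       ∎
  where open ≡-Reasoning

module _ {n : ℕ} where
  open DecMembership (_≟_ {n}) using (_∈?_)

  length≡∑-∈? : (L : List (Fin n)) → Unique L → length L ≡ ∑ (λ x → iverson (does (x ∈? L)))
  length≡∑-∈? [] _ = sym (sum-replicate-zero n)
  length≡∑-∈? (a ∷ L) (a∉L ∷ unique) = sym (begin
    ∑ (λ x → iverson (does (x ∈? (a ∷ L))))          ≡⟨ sum-cong-≗ ∈?-∷ ⟩
    ∑ (λ x → δ x a + iverson (does (x ∈? L)))        ≡⟨ ∑-distrib-+ (λ x → δ x a) _ ⟩
    ∑ (λ x → δ x a) + ∑ (λ x → iverson (does (x ∈? L)))
      ≡⟨ cong₂ _+_ (trans (sum-cong-≗ (λ x → δ-sym x a)) (∑-δ a)) (sym (length≡∑-∈? L unique)) ⟩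
    suc (length L)                                   ∎)
    where
    open ≡-Reasoning
    ∈?-∷ : ∀ x → iverson (does (x ∈? (a ∷ L))) ≡ δ x a + iverson (does (x ∈? L))
    ∈?-∷ x with x ≟ a | x ∈? L
    ... | yes refl | yes x∈L = ⊥-elim (All.lookup a∉L x∈L refl)
    ... | yes _ | no _ = refl
    ... | no _ | _ = refl

sum-tabulate : ∀ {n} (f : Fin n → ℕ) → sum (tabulate f) ≡ ∑ f
sum-tabulate {zero} f = refl
sum-tabulate {suc n} f = cong (f zero +_) (sum-tabulate (f ∘ suc))

ℙ-sum≡0⇒≡ : ∀ {a b : Parity} → a ℙ.+ b ≡ 0ℙ → b ≡ a
ℙ-sum≡0⇒≡ {0ℙ} {0ℙ} _ = refl
ℙ-sum≡0⇒≡ {1ℙ} {1ℙ} _ = refl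

ℙ-shift : ∀ {a b c d : Parity} → (b ℙ.+ c) ℙ.+ d ≡ a ℙ.+ b → d ≡ a ℙ.+ c
ℙ-shift {a} {b} {c} eq = Parityₚ.+-cancelˡ-≡ (b ℙ.+ c) _ _ (trans eq (sym (cancel a b c)))
  where
  cancel : ∀ a b c → (b ℙ.+ c) ℙ.+ (a ℙ.+ c) ≡ a ℙ.+ b
  cancel 0ℙ 0ℙ 0ℙ = refl
  cancel 0ℙ 0ℙ 1ℙ = refl
  cancel 0ℙ 1ℙ 0ℙ = refl
  cancel 0ℙ 1ℙ 1ℙ = refl
  cancel 1ℙ 0ℙ 0ℙ = refl
  cancel 1ℙ 0ℙ 1ℙ = refl
  cancel 1ℙ 1ℙ 0ℙ = refl
  cancel 1ℙ 1ℙ 1ℙ = refl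

[n+n]/2≡n : ∀ n → (n + n) / 2 ≡ n
[n+n]/2≡n n = trans (cong (_/ 2) (trans (cong (n +_) (sym (+-identityʳ n))) (*-comm 2 n))) (m*n/n≡m n 2)

even⇒half+half : ∀ {n} → 2 ∣ n → n ≡ n / 2 + n / 2
even⇒half+half (divides t refl) = begin
  t * 2             ≡⟨ *-comm t 2 ⟩
  t + (t + 0)       ≡⟨ cong (t +_) (+-identityʳ t) ⟩
  t + t             ≡⟨ cong₂ _+_ (sym (m*n/n≡m t 2)) (sym (m*n/n≡m t 2)) ⟩
  t * 2 / 2 + t * 2 / 2 ∎
  where open ≡-Reasoning

parity-even : ∀ {n} → 2 ∣ n → parity n ≡ 0ℙ
parity-even {n} 2∣n = trans (cong parity (even⇒half+half 2∣n))
  (trans (Parityₚ.+-homo-+ (n / 2) (n / 2)) (Parityₚ.p+p≡0ℙ (parity (n / 2))))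

Unique-++⁻ : {A : Set} (xs : List A) {ys : List A} → Unique (xs ++ ys) →
             Unique xs × Unique ys × (∀ {x} → x ∈ xs → x ∈ ys → ⊥)
Unique-++⁻ [] u = [] , u , λ ()
Unique-++⁻ (x ∷ xs) (x∉ ∷ u) with Unique-++⁻ xs u
... | uxs , uys , apart =
  AllP.++⁻ˡ xs x∉ ∷ uxs , uys ,
  λ { (here refl) y∈ → All.lookup (AllP.++⁻ʳ xs x∉) y∈ refl
    ; (there x∈) y∈ → apart x∈ y∈ }

Unique-resp-↭ : {A : Set} {xs ys : List A} → xs ↭ ys → Unique xs → Unique ys
Unique-resp-↭ {A} xs↭ys = PermSetoid.Unique-resp-↭ (setoid A) (↭⇒↭ₛ xs↭ys)

Unique-concatMap⁻ : {A B : Set} (f : A → List B) (F : List A) → Unique (concatMap f F) → All (Unique ∘ f) F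
Unique-concatMap⁻ f [] _ = []
Unique-concatMap⁻ f (a ∷ F) u with Unique-++⁻ (f a) u
... | ua , uF , _ = ua ∷ Unique-concatMap⁻ f F uF

module _ {n : ℕ} {A : Set} (f : A → List (Fin n)) where
  open DecMembership (_≟_ {n}) using (_∈?_)

  count-containing≡0 : ∀ F {x} → ¬ x ∈ concatMap f F → length (filter (λ a → x ∈? f a) F) ≡ 0
  count-containing≡0 [] _ = refl
  count-containing≡0 (a ∷ F) {x} x∉ with x ∈? f a
  ... | yes x∈ = ⊥-elim (x∉ (∈-++⁺ˡ x∈))
  ... | no _ = count-containing≡0 F (x∉ ∘ ∈-++⁺ʳ (f a))

  count-containing≡1 : ∀ F {x} → Unique (concatMap f F) → x ∈ concatMap f F →
                       length (filter (λ a → x ∈? f a) F) ≡ 1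
  count-containing≡1 (a ∷ F) {x} u x∈F with Unique-++⁻ (f a) u | x ∈? f a
  ... | _ , _ , apart | yes x∈a = cong suc (count-containing≡0 F (apart x∈a))
  ... | _ , uF , _ | no x∉a with ∈-++⁻ (f a) x∈F
  ...   | inj₁ x∈a = ⊥-elim (x∉a x∈a)
  ...   | inj₂ x∈F′ = count-containing≡1 F uF x∈F′

lastOr-∈ : {A : Set} (d y : A) (ys : List A) → lastOr d (y ∷ ys) ∈ y ∷ ys
lastOr-∈ d y [] = here refl
lastOr-∈ d y (z ∷ ys) = there (lastOr-∈ y z ys)

∈-nonempty : {A : Set} (xs : List A) {n : ℕ} → length xs ≡ suc n → ∃ λ x → x ∈ xs
∈-nonempty (x ∷ _) _ = x , here refl

module _ {A : Set} {P : A → Set} (P? : Relation.Unary.Decidable P) where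

  filter-[x]≡1⇒ : ∀ {x} → length (filter P? (x ∷ [])) ≡ 1 → P x
  filter-[x]≡1⇒ {x} once with P? x
  ... | yes px = px
  ... | no _ = case once of λ ()

  filter-[x]≡1⇐ : ∀ {x} → P x → length (filter P? (x ∷ [])) ≡ 1
  filter-[x]≡1⇐ {x} px with P? x
  ... | yes _ = refl
  ... | no ¬px = ⊥-elim (¬px px)

-- Chains of steps

Chain : {A B : Set} → (A → B × A → Set) → A → List (B × A) → Set
Chain R u [] = ⊤
Chain R u (s ∷ ss) = R u s × Chain R (proj₂ s) ss

endpoint : {A B : Set} → A → List (B × A) → A
endpoint u ss = lastOr u (map proj₂ ss)

endpoint-++ : {A B : Set} (u : A) (ss ts : List (B × A)) → endpoint u (ss ++ ts) ≡ endpoint (endpoint u ss) ts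
endpoint-++ u [] ts = refl
endpoint-++ u (s ∷ ss) ts = endpoint-++ (proj₂ s) ss ts

split-at-visit : {A B : Set} (u : A) (ss : List (B × A)) {x : A} → x ∈ map proj₂ ss →
                 Σ (List (B × A)) λ ss₁ → Σ (List (B × A)) λ ss₂ → ss ≡ ss₁ ++ ss₂ × endpoint u ss₁ ≡ x
split-at-visit u (s ∷ ss) (here refl) = s ∷ [] , ss , refl , refl
split-at-visit u (s ∷ ss) (there x∈) with split-at-visit (proj₂ s) ss x∈
... | ss₁ , ss₂ , refl , end = s ∷ ss₁ , ss₂ , refl , end

module _ {A B : Set} (R : A → B × A → Set) where

  Chain-++⁻ : ∀ u ss ts → Chain R u (ss ++ ts) → Chain R u ss × Chain R (endpoint u ss) ts
  Chain-++⁻ u [] ts c = tt , c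
  Chain-++⁻ u (s ∷ ss) ts (r , c) = Data.Product.map₁ (r ,_) (Chain-++⁻ (proj₂ s) ss ts c)

  Chain-++⁺ : ∀ u ss ts → Chain R u ss → Chain R (endpoint u ss) ts → Chain R u (ss ++ ts)
  Chain-++⁺ u [] ts _ c = c
  Chain-++⁺ u (s ∷ ss) ts (r , c) c′ = r , Chain-++⁺ (proj₂ s) ss ts c c′

  rotate : ∀ u ss ts → Chain R u (ss ++ ts) → endpoint u (ss ++ ts) ≡ u →
           Chain R (endpoint u ss) (ts ++ ss) × endpoint (endpoint u ss) (ts ++ ss) ≡ endpoint u ss
  rotate u ss ts c closed with css , cts ← Chain-++⁻ u ss ts c =
    Chain-++⁺ (endpoint u ss) ts ss cts (subst (λ w → Chain R w ss) (sym ts-closes) css) ,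
    trans (endpoint-++ (endpoint u ss) ts ss) (cong (λ w → endpoint w ss) ts-closes)
    where
    ts-closes : endpoint (endpoint u ss) ts ≡ u
    ts-closes = trans (sym (endpoint-++ u ss ts)) closed

  Chain-∈ : ∀ u ss {s} → Chain R u ss → s ∈ ss → Σ A λ v → v ∈ u ∷ map proj₂ ss × R v s
  Chain-∈ u (s ∷ ss) (r , c) (here refl) = u , here refl , r
  Chain-∈ u (s ∷ ss) (r , c) (there s∈) = Data.Product.map₂ (Data.Product.map₁ there) (Chain-∈ (proj₂ s) ss c s∈)

  rotate-to : ∀ u ss {x} → Chain R u ss → endpoint u ss ≡ u → x ∈ map proj₂ ss →
              Σ (List (B × A)) λ ss′ → Chain R x ss′ × endpoint x ss′ ≡ x × ss′ ↭ ss
  rotate-to u ss c closed x∈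
    with ss₁ , ss₂ , refl , refl ← split-at-visit u ss x∈
    with c′ , closed′ ← rotate u ss₁ ss₂ c closed = ss₂ ++ ss₁ , c′ , closed′ , ↭-++-comm ss₂ ss₁

-- The loopless multigraph on the vertices of G in which the edge e joins p e and q e.
module Circuits (G : Hypergraph) (p q : Fin (nE G) → Fin (nV G)) (p≢q : ∀ e → p e ≢ q e) where

  open DecMembership (_≟_ {nV G}) using (_∈?_)

  Vertex : Set
  Vertex = Fin (nV G)

  Edge : Set
  Edge = Fin (nE G)

  Step : Set
  Step = Edge × Vertex

  Joins : Vertex → Step → Set
  Joins u (e , w) = (p e ≡ u × q e ≡ w) ⊎ (q e ≡ u × p e ≡ w)

  Path : Vertex → List Step → Set
  Path = Chain Joins

  ends : Edge → Vertex → ℕ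
  ends e x = δ (p e) x + δ (q e) x

  ends-Joins : ∀ {u e w} x → Joins u (e , w) → ends e x ≡ δ u x + δ w x
  ends-Joins x (inj₁ (refl , refl)) = refl
  ends-Joins {e = e} x (inj₂ (refl , refl)) = +-comm (δ (p e) x) (δ (q e) x)

  degree : List Edge → Vertex → ℕ
  degree S x = sum (map (λ e → ends e x) S)

  degree-++ : ∀ S T x → degree (S ++ T) x ≡ degree S x + degree T x
  degree-++ S T x = trans (cong sum (Listₚ.map-++ _ S T)) (sum-++ (map (λ e → ends e x) S) _)

  degree-↭ : ∀ {S T} → S ↭ T → ∀ x → degree S x ≡ degree T x
  degree-↭ S↭T x = sum-↭ (↭-map⁺ _ S↭T)

  Even : List Edge → Set
  Even S = ∀ w → parity (degree S w) ≡ 0ℙ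

  OddExactlyAt : Vertex → Vertex → List Edge → Set
  OddExactlyAt x y S = ∀ w → parity (degree S w) ≡ parity (δ x w + δ y w)

  OddExactlyAt-same⇒Even : ∀ {x S} → OddExactlyAt x x S → Even S
  OddExactlyAt-same⇒Even {x} odd w =
    trans (odd w) (trans (Parityₚ.+-homo-+ (δ x w) (δ x w)) (Parityₚ.p+p≡0ℙ (parity (δ x w))))

  Even-∷⇒OddExactlyAt : ∀ {e S} → Even (e ∷ S) → OddExactlyAt (p e) (q e) S
  Even-∷⇒OddExactlyAt {e} {S} even w =
    ℙ-sum≡0⇒≡ (trans (sym (Parityₚ.+-homo-+ (ends e w) (degree S w))) (even w))

  odd-at-end : ∀ {x y S} → x ≢ y → OddExactlyAt x y S → parity (degree S y) ≡ 1ℙ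
  odd-at-end {x} {y} x≢y odd = trans (odd y) (cong parity (cong₂ _+_ (δ-≢ x≢y) (δ-≡ {x = y} refl)))

  incident-step : ∀ S {y} → parity (degree S y) ≡ 1ℙ → Σ Step λ s → proj₁ s ∈ S × Joins y s
  incident-step (e ∷ S) {y} odd with p e ≟ y
  ... | yes p≡y = (e , q e) , here refl , inj₁ (p≡y , refl)
  ... | no _ with q e ≟ y
  ...   | yes q≡y = (e , p e) , here refl , inj₂ (q≡y , refl)
  ...   | no _ = Data.Product.map₂ (Data.Product.map₁ there) (incident-step S odd)

  -- Leaving y along e flips the parity of the degree at both ends of e.
  OddExactlyAt-remove : ∀ {x y e z} S₁ S₂ → Joins y (e , z) →
                        OddExactlyAt x y (S₁ ++ e ∷ S₂) → OddExactlyAt x z (S₁ ++ S₂)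
  OddExactlyAt-remove {x} {y} {e} {z} S₁ S₂ y-e-z odd w = begin
    parity (degree (S₁ ++ S₂) w)          ≡⟨ ℙ-shift {parity (δ x w)} {parity (δ y w)} {parity (δ z w)} flipped ⟩
    parity (δ x w) ℙ.+ parity (δ z w)     ≡⟨ sym (Parityₚ.+-homo-+ (δ x w) (δ z w)) ⟩
    parity (δ x w + δ z w)                ∎
    where
    open ≡-Reasoning
    flipped : (parity (δ y w) ℙ.+ parity (δ z w)) ℙ.+ parity (degree (S₁ ++ S₂) w)
              ≡ parity (δ x w) ℙ.+ parity (δ y w)
    flipped = begin
      (parity (δ y w) ℙ.+ parity (δ z w)) ℙ.+ parity (degree (S₁ ++ S₂) w)
        ≡⟨ cong (ℙ._+ _) (sym (Parityₚ.+-homo-+ (δ y w) (δ z w))) ⟩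
      parity (δ y w + δ z w) ℙ.+ parity (degree (S₁ ++ S₂) w)
        ≡⟨ sym (Parityₚ.+-homo-+ (δ y w + δ z w) _) ⟩
      parity (δ y w + δ z w + degree (S₁ ++ S₂) w)
        ≡⟨ cong (λ k → parity (k + degree (S₁ ++ S₂) w)) (sym (ends-Joins w y-e-z)) ⟩
      parity (degree (e ∷ S₁ ++ S₂) w)
        ≡⟨ cong parity (sym (degree-↭ (shift e S₁ S₂) w)) ⟩
      parity (degree (S₁ ++ e ∷ S₂) w)
        ≡⟨ odd w ⟩
      parity (δ x w + δ y w)
        ≡⟨ Parityₚ.+-homo-+ (δ x w) (δ y w) ⟩
      parity (δ x w) ℙ.+ parity (δ y w) ∎

  endpoint≢⇒nonempty : ∀ {x y} (ss : List Step) → endpoint y ss ≡ x → x ≢ y → 1 ≤ length ss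
  endpoint≢⇒nonempty [] y≡x x≢y = ⊥-elim (x≢y (sym y≡x))
  endpoint≢⇒nonempty (_ ∷ _) _ _ = s≤s z≤n

  -- Walking from y along unused edges can only get stuck at the other odd vertex x.
  trail : ∀ S → Acc _<_ (length S) → ∀ {x y} → x ≢ y → OddExactlyAt x y S →
          Σ (List Step) λ ss → Σ (List Edge) λ R →
          Path y ss × endpoint y ss ≡ x × map proj₁ ss ++ R ↭ S × Even R
  trail S (acc shorter) {x} {y} x≢y odd
    with (e , z) , e∈S , y-e-z ← incident-step S (odd-at-end {S = S} x≢y odd)
    with S₁ , S₂ , refl ← ∈-∃++ e∈S
    with z ≟ x
  ... | yes refl = (e , x) ∷ [] , S₁ ++ S₂ , (y-e-z , tt) , refl , ↭-sym (shift e S₁ S₂) ,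
                   OddExactlyAt-same⇒Even {x} {S₁ ++ S₂} (OddExactlyAt-remove {x} S₁ S₂ y-e-z odd)
  ... | no z≢x with trail (S₁ ++ S₂) (shorter (≤-reflexive (sym (Listₚ.length-++-sucʳ S₁ e S₂)))) (z≢x ∘ sym) (OddExactlyAt-remove {x} S₁ S₂ y-e-z odd)
  ...   | ss , R , path , end , ss++R↭ , even =
    (e , z) ∷ ss , R , (y-e-z , path) , end , ↭-trans (prep e ss++R↭) (↭-sym (shift e S₁ S₂)) , even

  Circuit : Walk G → Set
  Circuit W = Path (start W) (steps W) × endV W ≡ start W × 2 ≤ length (steps W)

  visits : Walk G → List Vertex
  visits W = map proj₂ (steps W)

  VertexDisjoint : Walk G → Walk G → Set
  VertexDisjoint W₁ W₂ = Disjoint (visits W₁) (visits W₂)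

  merge : ∀ {C T x} → Circuit C → Circuit T → x ∈ visits C → x ∈ visits T →
          Σ (Walk G) λ C∪T → Circuit C∪T × steps C∪T ↭ steps C ++ steps T
  merge {mkWalk u cs} {mkWalk v ts} {x} (pathC , closedC , longC) (pathT , closedT , _) x∈C x∈T
    with cs′ , pathC′ , closedC′ , cs′↭ ← rotate-to Joins u cs pathC closedC x∈C
       | ts′ , pathT′ , closedT′ , ts′↭ ← rotate-to Joins v ts pathT closedT x∈T =
    mkWalk x (cs′ ++ ts′) ,
    ( Chain-++⁺ Joins x cs′ ts′ pathC′ (subst (λ w → Path w ts′) (sym closedC′) pathT′)
    , trans (endpoint-++ x cs′ ts′) (trans (cong (λ w → endpoint w ts′) closedC′) closedT′)
    , ≤-trans longC (≤-trans (≤-reflexive (sym (↭-length cs′↭))) (Listₚ.length-++-≤ˡ cs′)) ) ,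
    ++⁺ cs′↭ ts′↭

  stepsAll : List (Walk G) → List Step
  stepsAll = concatMap steps

  map-stepsAll-↭ : ∀ {X : Set} (f : Step → X) F′ {ss} F → stepsAll F′ ↭ ss ++ stepsAll F →
                   concatMap (map f ∘ steps) F′ ↭ map f ss ++ concatMap (map f ∘ steps) F
  map-stepsAll-↭ f F′ {ss} F perm =
    subst₂ _↭_ (Listₚ.map-concatMap f steps F′)
               (trans (Listₚ.map-++ f ss (stepsAll F)) (cong (map f ss ++_) (Listₚ.map-concatMap f steps F)))
               (↭-map⁺ f perm)

  Apart : Walk G → List (Walk G) → Set
  Apart T F = Disjoint (visits T) (concatMap visits F)

  All-VertexDisjoint⇒Apart : ∀ T F → All (VertexDisjoint T) F → Apart T F
  All-VertexDisjoint⇒Apart T (W ∷ F) (T#W ∷ T#F) x x∈T x∈F with ∈-++⁻ (visits W) x∈F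
  ... | inj₁ x∈W = T#W x x∈T x∈W
  ... | inj₂ x∈F′ = All-VertexDisjoint⇒Apart T F T#F x x∈T x∈F′

  Apart⇒All-VertexDisjoint : ∀ T F → Apart T F → All (VertexDisjoint T) F
  Apart⇒All-VertexDisjoint T [] _ = []
  Apart⇒All-VertexDisjoint T (W ∷ F) T#F =
    (λ x x∈T x∈W → T#F x x∈T (∈-++⁺ˡ x∈W)) ∷
    Apart⇒All-VertexDisjoint T F (λ x x∈T x∈F → T#F x x∈T (∈-++⁺ʳ (visits W) x∈F))

  insert : ∀ {C} → Circuit C → ∀ F → All Circuit F → AllPairs VertexDisjoint F →
           Σ (List (Walk G)) λ F′ → All Circuit F′ × AllPairs VertexDisjoint F′ ×
           stepsAll F′ ↭ steps C ++ stepsAll F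
  insert {C} circC [] _ _ = C ∷ [] , circC ∷ [] , [] ∷ [] , ↭-refl
  insert {C} circC (T ∷ F) (circT ∷ circF) (T#F ∷ pairsF) with any? (_∈? visits T) (visits C)
  ... | yes shared
    with x , x∈C , x∈T ← find shared
    with C∪T , circC∪T , C∪T↭ ← merge circC circT x∈C x∈T
    with F′ , circF′ , pairsF′ , F′↭ ← insert circC∪T F circF pairsF =
    F′ , circF′ , pairsF′ ,
    ↭-trans F′↭ (↭-trans (++⁺ʳ (stepsAll F) C∪T↭) (↭-++-assoc (steps C) (steps T) (stepsAll F)))
  ... | no apart
    with F′ , circF′ , pairsF′ , F′↭ ← insert circC F circF pairsF =
    T ∷ F′ , circT ∷ circF′ , Apart⇒All-VertexDisjoint T F′ T#F′ ∷ pairsF′ ,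
    ↭-trans (++⁺ˡ (steps T) F′↭) (shifts (steps T) (steps C))
    where
    T#F′ : Apart T F′
    T#F′ x x∈T x∈F′ with ∈-++⁻ (visits C) (∈-resp-↭ (map-stepsAll-↭ proj₂ F′ F F′↭) x∈F′)
    ... | inj₁ x∈C = apart (lose x∈C x∈T)
    ... | inj₂ x∈F = All-VertexDisjoint⇒Apart T F T#F x x∈T x∈F

  close-up : ∀ e ss → Path (q e) ss → endpoint (q e) ss ≡ p e → Circuit (mkWalk (p e) ((e , q e) ∷ ss))
  close-up e ss path end = (inj₁ (refl , refl) , path) , end , s≤s (endpoint≢⇒nonempty ss end (p≢q e))

  record Decomposition (S : List Edge) : Set where
    field
      circuits : List (Walk G)
      all-circuits : All Circuit circuits
      disjoint : AllPairs VertexDisjoint circuits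
      edges↭ : concatMap edgesOf circuits ↭ S

  -- Removing an edge a leaves odd degrees exactly at its ends, so a trail from q a back to p a
  -- closes a circuit through a.
  decompose : ∀ S → Acc _<_ (length S) → Even S → Decomposition S
  decompose [] _ _ = record { circuits = [] ; all-circuits = [] ; disjoint = [] ; edges↭ = ↭-refl }
  decompose (a ∷ S) (acc shorter) even
    with ss , R , path , end , ss++R↭S , evenR ← trail S (<-wellFounded _) (p≢q a) (Even-∷⇒OddExactlyAt {a} {S} even)
    with record { circuits = F ; all-circuits = circF ; disjoint = pairsF ; edges↭ = F↭R }
           ← decompose R (shorter (s≤s (≤-trans (Listₚ.length-++-≤ʳ R {map proj₁ ss}) (≤-reflexive (↭-length ss++R↭S))))) evenR
    with F′ , circF′ , pairsF′ , F′↭ ← insert (close-up a ss path end) F circF pairsF = record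
    { circuits = F′ ; all-circuits = circF′ ; disjoint = pairsF′
    ; edges↭ = ↭-trans (map-stepsAll-↭ proj₁ F′ F F′↭) (prep a (↭-trans (++⁺ˡ (map proj₁ ss) F↭R) ss++R↭S)) }

  path-degree : ∀ u ss x → Path u ss →
                degree (map proj₁ ss) x + δ (endpoint u ss) x ≡
                δ u x + (occurrences (map proj₂ ss) x + occurrences (map proj₂ ss) x)
  path-degree u [] x _ = +-comm 0 (δ u x)
  path-degree u ((e , w) ∷ ss) x (u-e-w , path) = begin
    ends e x + degree (map proj₁ ss) x + δ (endpoint w ss) x
      ≡⟨ +-assoc (ends e x) _ _ ⟩
    ends e x + (degree (map proj₁ ss) x + δ (endpoint w ss) x)
      ≡⟨ cong₂ _+_ (ends-Joins x u-e-w) (path-degree w ss x path) ⟩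
    δ u x + δ w x + (δ w x + (o + o))
      ≡⟨ solve 3 (λ a b c → (a :+ b) :+ (b :+ (c :+ c)) := a :+ ((b :+ c) :+ (b :+ c))) refl (δ u x) (δ w x) o ⟩
    δ u x + ((δ w x + o) + (δ w x + o))
      ≡⟨ cong (λ k → δ u x + (k + k)) (sym (occurrences-∷ w (map proj₂ ss) x)) ⟩
    δ u x + (occurrences (w ∷ map proj₂ ss) x + occurrences (w ∷ map proj₂ ss) x) ∎
    where
    open ≡-Reasoning
    open +-*-Solver
    o : ℕ
    o = occurrences (map proj₂ ss) x

  -- Each visit of a circuit to x accounts for two ends at x: one edge in, one edge out.
  circuit-degree : ∀ W x → Circuit W → degree (edgesOf W) x ≡ traversals W x + traversals W x
  circuit-degree (mkWalk u ss) x (path , closed , _) = +-cancelʳ-≡ (δ u x) _ _ (begin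
    degree (map proj₁ ss) x + δ u x            ≡⟨ cong (λ v → degree (map proj₁ ss) x + δ v x) (sym closed) ⟩
    degree (map proj₁ ss) x + δ (endpoint u ss) x ≡⟨ path-degree u ss x path ⟩
    δ u x + (t + t)                             ≡⟨ +-comm (δ u x) (t + t) ⟩
    t + t + δ u x                               ∎)
    where
    open ≡-Reasoning
    t : ℕ
    t = occurrences (map proj₂ ss) x

  family-degree : ∀ F x → All Circuit F → degree (concatMap edgesOf F) x ≡ familyTraversals F x + familyTraversals F x
  family-degree [] x [] = refl
  family-degree (W ∷ F) x (circW ∷ circF) = begin
    degree (edgesOf W ++ concatMap edgesOf F) x   ≡⟨ degree-++ (edgesOf W) (concatMap edgesOf F) x ⟩
    degree (edgesOf W) x + degree (concatMap edgesOf F) x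
      ≡⟨ cong₂ _+_ (circuit-degree W x circW) (family-degree F x circF) ⟩
    (t + t) + (ft + ft)                           ≡⟨ solve 2 (λ a b → (a :+ a) :+ (b :+ b) := (a :+ b) :+ (a :+ b)) refl t ft ⟩
    (t + ft) + (t + ft)                           ∎
    where
    open ≡-Reasoning
    open +-*-Solver
    t ft : ℕ
    t = traversals W x
    ft = familyTraversals F x

  anchor-visited : ∀ W {x} → Circuit W → x ∈ anchors W → x ∈ visits W
  anchor-visited (mkWalk u ((e , w) ∷ ss)) (_ , closed , _) (here refl) =
    subst (_∈ map proj₂ ((e , w) ∷ ss)) closed (lastOr-∈ u w (map proj₂ ss))
  anchor-visited W _ (there x∈) = x∈

  anchors-disjoint : ∀ F → All Circuit F → AllPairs VertexDisjoint F →
                     AllPairs (λ W₁ W₂ → Disjoint (anchors W₁) (anchors W₂)) F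
  anchors-disjoint [] [] [] = []
  anchors-disjoint (W ∷ F) (circW ∷ circF) (W#F ∷ pairs) =
    All.zipWith (λ {W′} (circW′ , W#W′) x x∈W x∈W′ → W#W′ x (anchor-visited W circW x∈W) (anchor-visited W′ circW′ x∈W′))
                (circF , W#F)
    ∷ anchors-disjoint F circF pairs

  module _ (p∈ : ∀ e → inc G e (p e) ≡ true) (q∈ : ∀ e → inc G e (q e) ≡ true) where

    Path⇒ValidFrom : ∀ u ss → Path u ss → ValidFrom G u ss
    Path⇒ValidFrom u [] _ = tt
    Path⇒ValidFrom u ((e , w) ∷ ss) (inj₁ (refl , refl) , path) = p≢q e , p∈ e , q∈ e , Path⇒ValidFrom w ss path
    Path⇒ValidFrom u ((e , w) ∷ ss) (inj₂ (refl , refl) , path) = p≢q e ∘ sym , q∈ e , p∈ e , Path⇒ValidFrom w ss path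

    module _ (D : Decomposition (allFin (nE G))) where
      open Decomposition D

      edges-unique : Unique (concatMap edgesOf circuits)
      edges-unique = Unique-resp-↭ (↭-sym edges↭) (Uniqueₚ.allFin⁺ (nE G))

      edge-covered : ∀ e → e ∈ concatMap edgesOf circuits
      edge-covered e = ∈-resp-↭ (↭-sym edges↭) (∈-tabulate⁺ e)

      isEulerFamily : IsEulerFamily G circuits
      isEulerFamily = closed-strict circuits all-circuits (Unique-concatMap⁻ edgesOf circuits edges-unique)
                    , anchors-disjoint circuits all-circuits disjoint
                    , λ e → count-containing≡1 edgesOf circuits edges-unique (edge-covered e)
        where
        closed-strict : ∀ F → All Circuit F → All IsStrict F → All (IsClosedStrictTrail G) F
        closed-strict [] [] [] = []
        closed-strict (W ∷ F) ((path , closed , long) ∷ circF) (strict ∷ strictF) =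
          (Path⇒ValidFrom (start W) (steps W) path , (long , closed) , strict) ∷ closed-strict F circF strictF

      anchor-is-end : ∀ {W x} → W ∈ circuits → x ∈ anchors W → Σ Edge λ e → p e ≡ x ⊎ q e ≡ x
      anchor-is-end {W} W∈ x∈ with All.lookup all-circuits W∈
      ... | circW@(path , _) with ∈-map⁻ proj₂ (anchor-visited W circW x∈)
      ...   | (e , _) , s∈ , refl with Chain-∈ Joins (start W) (steps W) path s∈
      ...     | _ , _ , inj₁ (_ , q≡x) = e , inj₂ q≡x
      ...     | _ , _ , inj₂ (_ , p≡x) = e , inj₁ p≡x

      ends-are-anchors : ∀ e → Σ (Walk G) λ W → W ∈ circuits × p e ∈ anchors W × q e ∈ anchors W
      ends-are-anchors e with find (∈-concatMap⁻ edgesOf (edge-covered e))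
      ... | W , W∈ , e∈W with ∈-map⁻ proj₁ e∈W
      ...   | (_ , w) , s∈ , refl with Chain-∈ Joins (start W) (steps W) (proj₁ (All.lookup all-circuits W∈)) s∈
      ...     | u , u∈ , inj₁ (refl , refl) = W , W∈ , u∈ , there (∈-map⁺ proj₂ s∈)
      ...     | u , u∈ , inj₂ (refl , refl) = W , W∈ , there (∈-map⁺ proj₂ s∈) , u∈

-- Two-factors of a hypergraph and Euler families of its dual

ValidStep : (G : Hypergraph) → Fin (nV G) → Fin (nE G) × Fin (nV G) → Set
ValidStep G u (e , w) = u ≢ w × inc G e u ≡ true × inc G e w ≡ true

ValidFrom⇒Chain : ∀ G u ss → ValidFrom G u ss → Chain (ValidStep G) u ss
ValidFrom⇒Chain G u [] _ = tt
ValidFrom⇒Chain G u ((e , w) ∷ ss) (u≢w , e∋u , e∋w , valid) = (u≢w , e∋u , e∋w) , ValidFrom⇒Chain G w ss valid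

module _ (G : Hypergraph) where
  open DecMembership (_≟_ {nE G}) using (_∈?_)

  -- Both sides count the pairs (W, step of W): by anchor on the left, by edge on the right.
  ∑-familyTraversals : (Ws : List (Walk G)) → All IsStrict Ws →
                       (∀ e → length (filter (λ W → e ∈? edgesOf W) Ws) ≡ 1) →
                       ∑ (familyTraversals Ws) ≡ ∑ (λ (_ : Fin (nE G)) → 1)
  ∑-familyTraversals Ws strict once = begin
    ∑ (λ x → sum (map (λ W → traversals W x) Ws))        ≡⟨ ∑-sum-comm (λ W x → traversals W x) Ws ⟩
    sum (map (λ W → ∑ (traversals W)) Ws)                ≡⟨ cong sum (Listₚ.map-cong-local (All.map (λ {W} → ∑-traversals {W}) strict)) ⟩
    sum (map (λ W → ∑ (λ e → iverson (does (e ∈? edgesOf W)))) Ws)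
      ≡⟨ sym (∑-sum-comm (λ W e → iverson (does (e ∈? edgesOf W))) Ws) ⟩
    ∑ (λ e → sum (map (λ W → iverson (does (e ∈? edgesOf W))) Ws))
      ≡⟨ sum-cong-≗ (λ e → trans (sym (length-filter≡sum (λ W → e ∈? edgesOf W) Ws)) (once e)) ⟩
    ∑ (λ (_ : Fin (nE G)) → 1)                           ∎
    where
    open ≡-Reasoning
    ∑-traversals : ∀ {W : Walk G} → IsStrict W → ∑ (traversals W) ≡ ∑ (λ e → iverson (does (e ∈? edgesOf W)))
    ∑-traversals {W} strictW = begin
      ∑ (occurrences (map proj₂ (steps W)))  ≡⟨ ∑-occurrences (map proj₂ (steps W)) ⟩
      length (map proj₂ (steps W))          ≡⟨ Listₚ.length-map proj₂ (steps W) ⟩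
      length (steps W)                      ≡⟨ sym (Listₚ.length-map proj₁ (steps W)) ⟩
      length (edgesOf W)                    ≡⟨ length≡∑-∈? (edgesOf W) strictW ⟩
      ∑ (λ e → iverson (does (e ∈? edgesOf W))) ∎

module _ (H : Hypergraph) (E′ : Fin (nE H) → Bool) where
  open DecMembership (_≟_ {nV H}) using (_∈?_)

  InE′ : Fin (nV H) → Fin (nE H) → Bool
  InE′ v e = E′ e ∧ inc H e v

  DualEulerFamily : Set
  DualEulerFamily =
    Σ (List (Walk (dual H))) λ Ws → IsEulerFamily (dual H) Ws × familyAnchorSetIs (dual H) Ws E′ ×
      (∀ e → E′ e ≡ true → familyTraversals Ws e ≡ edgeSize H e / 2)

  DualEulerTour : Set
  DualEulerTour =
    Σ (Walk (dual H)) λ W → IsEulerTour (dual H) W × tourAnchorSetIs (dual H) W E′ ×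
      (∀ e → E′ e ≡ true → traversals W e ≡ edgeSize H e / 2)

  countF-InE′ : ∀ e → countF (λ v → InE′ v e) ≡ (if E′ e then edgeSize H e else 0)
  countF-InE′ e with E′ e
  ... | true = refl
  ... | false = countF-false {nV H}

  -- Every vertex v of H becomes the graph edge {p v, q v} of the dual, joining the two edges of E′ through v.
  module TwoFactor (twoFactor : IsTwoFactor H E′) where

    module Pair (v : Fin (nV H)) = ExactlyTwo (countF≡2⇒ExactlyTwo (InE′ v) (twoFactor v))
    open Pair using () renaming (fst to p; snd to q; fst≢snd to p≢q; f-fst to p-InE′; f-snd to q-InE′; fst-or-snd to p-or-q)

    open Circuits (dual H) p q p≢q

    ends≡InE′ : ∀ v e → ends v e ≡ iverson (InE′ v e)
    ends≡InE′ v e with p v ≟ e | q v ≟ e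
    ... | yes refl | yes q≡p = ⊥-elim (p≢q v (sym q≡p))
    ... | yes refl | no _ rewrite p-InE′ v = refl
    ... | no _ | yes refl rewrite q-InE′ v = refl
    ... | no p≢e | no q≢e with InE′ v e in v∈e
    ...   | false = refl
    ...   | true with p-or-q v e v∈e
    ...     | inj₁ e≡p = ⊥-elim (p≢e (sym e≡p))
    ...     | inj₂ e≡q = ⊥-elim (q≢e (sym e≡q))

    degree-allFin : ∀ e → degree (allFin (nV H)) e ≡ (if E′ e then edgeSize H e else 0)
    degree-allFin e = begin
      sum (map (λ v → ends v e) (tabulate (λ v → v)))  ≡⟨ cong sum (Listₚ.map-tabulate (λ v → v) (λ v → ends v e)) ⟩
      sum (tabulate (λ v → ends v e))                  ≡⟨ sum-tabulate (λ v → ends v e) ⟩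
      ∑ (λ v → ends v e)                               ≡⟨ sum-cong-≗ (λ v → ends≡InE′ v e) ⟩
      ∑ (λ v → iverson (InE′ v e))                     ≡⟨ sym (countF≡∑ (λ v → InE′ v e)) ⟩
      countF (λ v → InE′ v e)                          ≡⟨ countF-InE′ e ⟩
      (if E′ e then edgeSize H e else 0)               ∎
      where open ≡-Reasoning

    even-degrees : (∀ e → 2 ∣ edgeSize H e) → Even (allFin (nV H))
    even-degrees even-size e with E′ e | degree-allFin e
    ... | true | deg≡ = trans (cong parity deg≡) (parity-even (even-size e))
    ... | false | deg≡ = cong parity deg≡

    p∈ : ∀ v → inc H (p v) v ≡ true
    p∈ v = proj₂ (∧-true⁻ (p-InE′ v))

    q∈ : ∀ v → inc H (q v) v ≡ true
    q∈ v = proj₂ (∧-true⁻ (q-InE′ v))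

    eulerFamily : (∀ e → 2 ∣ edgeSize H e) → (∀ e → 1 ≤ edgeSize H e) → DualEulerFamily
    eulerFamily even-size nonempty = circuits , isEulerFamily p∈ q∈ D , anchorSet , traversals≡
      where
      D : Decomposition (allFin (nV H))
      D = decompose (allFin (nV H)) (<-wellFounded _) (even-degrees even-size)
      open Decomposition D
      anchorSet : familyAnchorSetIs (dual H) circuits E′
      anchorSet e = anchor⇒E′ , E′⇒anchor
        where
        anchor⇒E′ : Σ (Walk (dual H)) (λ W → W ∈ circuits × e ∈ anchors W) → E′ e ≡ true
        anchor⇒E′ (W , W∈ , e∈) with anchor-is-end p∈ q∈ D W∈ e∈
        ... | v , inj₁ refl = proj₁ (∧-true⁻ (p-InE′ v))
        ... | v , inj₂ refl = proj₁ (∧-true⁻ (q-InE′ v))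
        E′⇒anchor : E′ e ≡ true → Σ (Walk (dual H)) (λ W → W ∈ circuits × e ∈ anchors W)
        E′⇒anchor e∈E′ with v , e∋v ← countF-witness (inc H e) (nonempty e)
          with p-or-q v e (∧-true⁺ e∈E′ e∋v) | ends-are-anchors p∈ q∈ D v
        ... | inj₁ refl | W , W∈ , p∈W , _ = W , W∈ , p∈W
        ... | inj₂ refl | W , W∈ , _ , q∈W = W , W∈ , q∈W
      traversals≡ : ∀ e → E′ e ≡ true → familyTraversals circuits e ≡ edgeSize H e / 2
      traversals≡ e e∈E′ = sym (begin
        edgeSize H e / 2                                 ≡⟨ cong (λ b → (if b then edgeSize H e else 0) / 2) (sym e∈E′) ⟩
        (if E′ e then edgeSize H e else 0) / 2           ≡⟨ cong (_/ 2) (sym (degree-allFin e)) ⟩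
        degree (allFin (nV H)) e / 2                     ≡⟨ cong (_/ 2) (sym (degree-↭ edges↭ e)) ⟩
        degree (concatMap edgesOf circuits) e / 2        ≡⟨ cong (_/ 2) (family-degree circuits e all-circuits) ⟩
        (familyTraversals circuits e + familyTraversals circuits e) / 2 ≡⟨ [n+n]/2≡n _ ⟩
        familyTraversals circuits e                      ∎)
        where open ≡-Reasoning

  record Crossing (Ws : List (Walk (dual H))) (v : Fin (nV H)) : Set where
    field
      trail : Walk (dual H)
      trail∈ : trail ∈ Ws
      from to : Fin (nE H)
      from∈ : from ∈ anchors trail
      to∈ : to ∈ anchors trail
      from≢to : from ≢ to
      v∈from : InE′ v from ≡ true
      v∈to : InE′ v to ≡ true

  crossing : ∀ {Ws} → IsEulerFamily (dual H) Ws → familyAnchorSetIs (dual H) Ws E′ → ∀ v → Crossing Ws v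
  crossing {Ws} (trails , _ , once) anchorSet v
    with T , T∈filter ← ∈-nonempty (filter (λ T → v ∈? edgesOf T) Ws) (once v)
    with T∈ , v∈T ← ∈-filter⁻ (λ T → v ∈? edgesOf T) T∈filter
    with (_ , w) , s∈ , refl ← ∈-map⁻ proj₁ v∈T
    with valid , _ ← All.lookup trails T∈
    with u , u∈T , u≢w , u∋v , w∋v ← Chain-∈ (ValidStep (dual H)) (start T) (steps T)
                                        (ValidFrom⇒Chain (dual H) (start T) (steps T) valid) s∈ =
    record { trail = T ; trail∈ = T∈ ; from = u ; to = w ; from∈ = u∈T ; to∈ = w∈T ; from≢to = u≢w
           ; v∈from = in-E′ u∈T u∋v ; v∈to = in-E′ w∈T w∋v }
    where
    w∈T : w ∈ anchors T
    w∈T = there (∈-map⁺ proj₂ s∈)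
    in-E′ : ∀ {a} → a ∈ anchors T → inc H a v ≡ true → InE′ v a ≡ true
    in-E′ a∈T = ∧-true⁺ (proj₁ (anchorSet _) (T , T∈ , a∈T))

  eulerFamily⇒twoFactor : (∀ e → 2 ∣ edgeSize H e) → DualEulerFamily → IsTwoFactor H E′
  eulerFamily⇒twoFactor even-size (Ws , family@(trails , _ , once) , anchorSet , traversals≡) v =
    sym (∑-squeeze (λ _ → 2) count at-least-two ∑count≤∑2 v)
    where
    count : Fin (nV H) → ℕ
    count v = countF (InE′ v)
    at-least-two : ∀ v → 2 ≤ count v
    at-least-two v = countF-≥2 (InE′ v) from≢to v∈from v∈to
      where open Crossing (crossing family anchorSet v)
    ft : Fin (nE H) → ℕ
    ft = familyTraversals Ws
    size≤ : ∀ e → countF (λ v → InE′ v e) ≤ ft e + ft e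
    size≤ e = ≤-trans (≤-reflexive (countF-InE′ e)) (bound (E′ e) refl)
      where
      bound : ∀ b → E′ e ≡ b → (if b then edgeSize H e else 0) ≤ ft e + ft e
      bound false _ = z≤n
      bound true e∈E′ = ≤-reflexive (trans (even⇒half+half (even-size e)) (cong₂ _+_ ft≡ ft≡))
        where
        ft≡ : edgeSize H e / 2 ≡ ft e
        ft≡ = sym (traversals≡ e e∈E′)
    ∑count≤∑2 : ∑ count ≤ ∑ (λ (_ : Fin (nV H)) → 2)
    ∑count≤∑2 = begin
      ∑ count                                             ≡⟨ sum-cong-≗ (λ v → countF≡∑ (InE′ v)) ⟩
      ∑ (λ v → ∑ (λ e → iverson (InE′ v e)))              ≡⟨ ∑-comm (λ v e → iverson (InE′ v e)) ⟩
      ∑ (λ e → ∑ (λ v → iverson (InE′ v e)))              ≡⟨ sum-cong-≗ (λ e → sym (countF≡∑ (λ v → InE′ v e))) ⟩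
      ∑ (λ e → countF (λ v → InE′ v e))                   ≤⟨ ∑-mono-≤ size≤ ⟩
      ∑ (λ e → ft e + ft e)                               ≡⟨ ∑-distrib-+ ft ft ⟩
      ∑ ft + ∑ ft                                         ≡⟨ cong₂ _+_ ∑ft ∑ft ⟩
      ∑ (λ (_ : Fin (nV H)) → 1) + ∑ (λ (_ : Fin (nV H)) → 1) ≡⟨ sym (∑-distrib-+ {nV H} (λ _ → 1) (λ _ → 1)) ⟩
      ∑ (λ (_ : Fin (nV H)) → 2)                          ∎
      where
      open ≤-Reasoning
      ∑ft : ∑ ft ≡ ∑ (λ (_ : Fin (nV H)) → 1)
      ∑ft = ∑-familyTraversals (dual H) Ws (All.map (λ trail → proj₂ (proj₂ trail)) trails) once

  module SingleTrail (twoFactor : IsTwoFactor H E′) (connected : IsConnectedSub H E′)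
                     (nonempty : ∀ e → 1 ≤ edgeSize H e)
                     (W : Walk (dual H)) (rest : List (Walk (dual H)))
                     (family : IsEulerFamily (dual H) (W ∷ rest))
                     (anchorSet : familyAnchorSetIs (dual H) (W ∷ rest) E′) where

    anchor∈E′ : ∀ {T a} → T ∈ W ∷ rest → a ∈ anchors T → E′ a ≡ true
    anchor∈E′ {T} T∈ a∈T = proj₁ (anchorSet _) (T , T∈ , a∈T)

    W#rest : All (λ T → Disjoint (anchors W) (anchors T)) rest
    W#rest = AllPairs.head (proj₁ (proj₂ family))

    same-trail : ∀ {T a} → T ∈ W ∷ rest → a ∈ anchors W → a ∈ anchors T → T ≡ W
    same-trail (here refl) _ _ = refl
    same-trail {a = a} (there T∈) a∈W a∈T = ⊥-elim (All.lookup W#rest T∈ a a∈W a∈T)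

    -- The crossing of x joins two edges of E′ through x, and by the 2-factor property there are no others.
    shared-vertex : ∀ x {g g′} → InE′ x g ≡ true → InE′ x g′ ≡ true → g ∈ anchors W → g′ ∈ anchors W
    shared-vertex x {g} {g′} x∈g x∈g′ g∈W = subst (λ T → g′ ∈ anchors T) trail≡W (in-trail g′ x∈g′)
      where
      open Crossing (crossing family anchorSet x)
      in-trail : ∀ h → InE′ x h ≡ true → h ∈ anchors trail
      in-trail h x∈h with ExactlyTwo.any-two (countF≡2⇒ExactlyTwo (InE′ x) (twoFactor x)) from≢to v∈from v∈to h x∈h
      ... | inj₁ refl = from∈
      ... | inj₂ refl = to∈
      trail≡W : trail ≡ W
      trail≡W = same-trail trail∈ g∈W (in-trail g x∈g)

    MeetsW : Fin (nV H) → Set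
    MeetsW x = Σ (Fin (nE H)) λ g → InE′ x g ≡ true × g ∈ anchors W

    MeetsW-along : ∀ x ss → ValidFrom H x ss → All (λ e → E′ e ≡ true) (map proj₁ ss) →
                   MeetsW x → MeetsW (lastOr x (map proj₂ ss))
    MeetsW-along x [] _ _ meets = meets
    MeetsW-along x ((f , y) ∷ ss) (_ , f∋x , f∋y , valid) (f∈E′ ∷ E′ss) (g , x∈g , g∈W) =
      MeetsW-along y ss valid E′ss (f , ∧-true⁺ f∈E′ f∋y , shared-vertex x x∈g (∧-true⁺ f∈E′ f∋x) g∈W)

    E′⊆anchors : ∀ e → E′ e ≡ true → e ∈ anchors W
    E′⊆anchors e e∈E′
      with u , start∋u ← countF-witness (inc H (start W)) (nonempty (start W))
      with w , e∋w ← countF-witness (inc H e) (nonempty e)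
      with u ≟ w
    ... | yes refl = shared-vertex u (∧-true⁺ (anchor∈E′ (here refl) (here refl)) start∋u) (∧-true⁺ e∈E′ e∋w) (here refl)
    ... | no u≢w
      with walk , valid , refl , end , E′walk ← connected u w u≢w
      with g , w∈g , g∈W ← MeetsW-along (start walk) (steps walk) valid E′walk
                             (start W , ∧-true⁺ (anchor∈E′ (here refl) (here refl)) start∋u , here refl) =
      shared-vertex w (subst (λ x → InE′ x g ≡ true) end w∈g) (∧-true⁺ e∈E′ e∋w) g∈W

    no-other-trail : ∀ {T} → T ∈ rest → ⊥
    no-other-trail {T} T∈ = All.lookup W#rest T∈ (start T) (E′⊆anchors (start T) (anchor∈E′ (there T∈) (here refl))) (here refl)

  connectedTwoFactor⇒eulerTour : 1 ≤ nV H → (∀ e → 2 ∣ edgeSize H e) → (∀ e → 1 ≤ edgeSize H e) →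
                                 IsTwoFactor H E′ × IsConnectedSub H E′ → DualEulerTour
  connectedTwoFactor⇒eulerTour nV≥1 even-size nonempty (twoFactor , connected)
    with TwoFactor.eulerFamily twoFactor even-size nonempty
  ... | [] , (_ , _ , once) , _ = case once (Data.Fin.fromℕ< nV≥1) of λ ()
  ... | W ∷ T ∷ _ , family , anchorSet , _ =
    ⊥-elim (SingleTrail.no-other-trail twoFactor connected nonempty W (T ∷ _) family anchorSet (here refl))
  ... | W ∷ [] , family@(trail ∷ [] , _ , once) , anchorSet , traversals≡ =
    W , (trail , λ v → filter-[x]≡1⇒ (λ W → v ∈? edgesOf W) (once v)) ,
    (λ e → (λ e∈W → proj₁ (anchorSet e) (W , here refl , e∈W)) , E′⊆anchors e) ,
    (λ e e∈E′ → trans (sym (+-identityʳ (traversals W e))) (traversals≡ e e∈E′))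
    where open SingleTrail twoFactor connected nonempty W [] family anchorSet using (E′⊆anchors)

  -- Reading the trail a₀ (u₁,a₁) (u₂,a₂) … of the dual as the walk u a₀ u₁ a₁ u₂ … of H.
  dual-trail⇒walk : ∀ {u a} ss {v} → inc H a u ≡ true → E′ a ≡ true → Chain (ValidStep (dual H)) a ss →
                    Unique (u ∷ map proj₁ ss) → All (λ s → E′ (proj₂ s) ≡ true) ss → v ∈ map proj₁ ss →
                    Σ (List (Fin (nE H) × Fin (nV H))) λ L →
                      ValidFrom H u L × lastOr u (map proj₂ L) ≡ v × All (λ e → E′ e ≡ true) (map proj₁ L)
  dual-trail⇒walk {u} {a} ((u₁ , a₁) ∷ ss) a∋u a∈E′ ((_ , a∋u₁ , a₁∋u₁) , chain) ((u≢u₁ ∷ _) ∷ unique) (a₁∈E′ ∷ E′ss) v∈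
    with v∈
  ... | here refl = (a , u₁) ∷ [] , (u≢u₁ , a∋u , a∋u₁ , tt) , refl , a∈E′ ∷ []
  ... | there v∈ss with L , valid , end , E′L ← dual-trail⇒walk ss a₁∋u₁ a₁∈E′ chain unique E′ss v∈ss =
    (a , u₁) ∷ L , (u≢u₁ , a∋u , a∋u₁ , valid) , end , a∈E′ ∷ E′L

  closed-trail⇒walk : ∀ {a} A B {u x v} → let ss = A ++ (u , x) ∷ B in
                      Chain (ValidStep (dual H)) a ss → endpoint a ss ≡ a → Unique (map proj₁ ss) →
                      All (λ s → E′ (proj₂ s) ≡ true) ss → v ∈ map proj₁ ss → u ≢ v →
                      Σ (List (Fin (nE H) × Fin (nV H))) λ L →
                        ValidFrom H u L × lastOr u (map proj₂ L) ≡ v × All (λ e → E′ e ≡ true) (map proj₁ L)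
  closed-trail⇒walk {a} A B {u} {x} {v} chain closed unique E′ss v∈ u≢v
    with ((_ , _ , x∋u) , chain′) , _ ← rotate (ValidStep (dual H)) a A ((u , x) ∷ B) chain closed =
    dual-trail⇒walk (B ++ A) x∋u (All.lookup E′ss (∈-++⁺ʳ A (here refl))) chain′
                    (Unique-resp-↭ (↭-map⁺ proj₁ rotated↭) unique) (AllP.++⁻ʳ ((u , x) ∷ []) (All-resp-↭ rotated↭ E′ss)) v∈B++A
    where
    rotated↭ : A ++ (u , x) ∷ B ↭ (u , x) ∷ B ++ A
    rotated↭ = ↭-++-comm A ((u , x) ∷ B)
    v∈B++A : v ∈ map proj₁ (B ++ A)
    v∈B++A with ∈-resp-↭ (↭-map⁺ proj₁ rotated↭) v∈
    ... | here v≡u = ⊥-elim (u≢v (sym v≡u))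
    ... | there v∈′ = v∈′

  eulerTour⇒connected : DualEulerTour → IsConnectedSub H E′
  eulerTour⇒connected (mkWalk a st , ((valid , (_ , closed) , strict) , covers) , anchorSet , _) u v u≢v
    with (_ , x) , s∈ , refl ← ∈-map⁻ proj₁ (covers u)
    with A , B , refl ← ∈-∃++ s∈
    with L , validL , end , E′L ← closed-trail⇒walk A B (ValidFrom⇒Chain (dual H) a (A ++ (u , x) ∷ B) valid) closed
                                    strict (All.tabulate (λ s∈ → proj₁ (anchorSet _) (there (∈-map⁺ proj₂ s∈))))
                                    (covers v) u≢v =
    mkWalk u L , validL , refl , end , E′L

  eulerTour⇒eulerFamily : DualEulerTour → DualEulerFamily
  eulerTour⇒eulerFamily (W , (trail , covers) , anchorSet , traversals≡) =
    W ∷ [] , (trail ∷ [] , [] ∷ [] , λ v → filter-[x]≡1⇐ (λ W → v ∈? edgesOf W) (covers v)) ,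
    (λ e → (λ { (_ , here refl , e∈W) → proj₁ (anchorSet e) e∈W }) , λ e∈E′ → W , here refl , proj₂ (anchorSet e) e∈E′) ,
    (λ e e∈E′ → trans (+-identityʳ (traversals W e)) (traversals≡ e e∈E′))

mainTheorem20 : (H : Hypergraph) → 1 ≤ nV H → 1 ≤ nE H →
    (∀ (e : Fin (nE H)) → 1 ≤ edgeSize H e) →
    (∀ (e : Fin (nE H)) → 2 ∣ edgeSize H e) →
    (E' : Fin (nE H) → Bool) →
    (IsTwoFactor H E' ⇔
      Σ (List (Walk (dual H))) (λ Ws → IsEulerFamily (dual H) Ws ×
        familyAnchorSetIs (dual H) Ws E' ×
        (∀ (e : Fin (nE H)) → E' e ≡ true → familyTraversals Ws e ≡ edgeSize H e / 2)))
    × ((IsTwoFactor H E' × IsConnectedSub H E') ⇔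
      Σ (Walk (dual H)) (λ W → IsEulerTour (dual H) W ×
        tourAnchorSetIs (dual H) W E' ×
        (∀ (e : Fin (nE H)) → E' e ≡ true → traversals W e ≡ edgeSize H e / 2)))
mainTheorem20 H nV≥1 _ nonempty even-size E′ =
  mk⇔ (λ twoFactor → TwoFactor.eulerFamily H E′ twoFactor even-size nonempty)
      (eulerFamily⇒twoFactor H E′ even-size) ,
  mk⇔ (connectedTwoFactor⇒eulerTour H E′ nV≥1 even-size nonempty)
      (λ tour → eulerFamily⇒twoFactor H E′ even-size (eulerTour⇒eulerFamily H E′ tour) , eulerTour⇒connected H E′ tour)
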